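{- Let $s$ be a fully normalized binary string of length $n \ge 5$. Then there is a prefix block-interchange $\beta(1,x,y,z)$ applicable to $s$ that is a $3$-pblockInterchange, i.e. after applying it and normalizing, the resulting string has length $n-3$.
   Context: A binary string is $s=s[1]s[2]\ldots s[n]$ with each $s[i]\in\{0,1\}$. A string is normalized if no two adjacent symbols are equal; normalizing a string means replacing every maximal run of identical adjacent symbols by a single copy of that symbol. A fully normalized binary string is a normalized string over $\{0,1\}$ in which both symbols $0$ and $1$ occur. For a string $s$ of length $n$ and $1\le x<y\le z\le n$, the prefix block-interchange $\beta(1,x,y,z)$ transforms $s$ into $s[y]\ldots s[z]\,s[x+1]\ldots s[y-1]\,s[1]\ldots s[x]\,s[z+1]\ldots s[n]$ (exchanging the prefix $s[1..x]$ with the block $s[y..z]$). An operation applied to a normalized string of length $n$ is called an $l$-pblockInterchange if the normalized form of the resulting string has length $n-l$. -}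

module Defs where

open import Data.Bool using (Bool; true; false; _∧_)
open import Data.List using (List; []; _∷_; _++_; take; drop; length)
open import Data.List.Membership.Propositional using (_∈_)
open import Data.Nat using (ℕ; _∸_; _+_; _≤_; _<_)
open import Data.Product using (_×_; Σ; ∃-syntax)
open import Relation.Binary.PropositionalEquality using (_≡_; _≢_)
open import Relation.Nullary using (¬_)
open import Data.Bool.Properties using (_≟_)
open import Relation.Nullary.Decidable using (does)

-- binary strings: symbols 0/1 represented by false/true
BinString : Set
BinString = List Bool

data Normalized : BinString → Set where
  nil  : Normalized []
  one  : ∀ a → Normalized (a ∷ [])
  cons : ∀ a b s → a ≢ b → Normalized (b ∷ s) → Normalized (a ∷ b ∷ s)

FullyNormalized : BinString → Set
FullyNormalized s = Normalized s × (false ∈ s) × (true ∈ s)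

-- normalization: replace every maximal run by a single copy
-- normalize-from a s : normalized form of (a ∷ s)
normalize-from : Bool → BinString → BinString
normalize-from a [] = a ∷ []
normalize-from a (b ∷ s) with does (a ≟ b)
... | true  = normalize-from b s
... | false = a ∷ normalize-from b s

normalize : BinString → BinString
normalize [] = []
normalize (a ∷ s) = normalize-from a s

-- 1-indexed substring s[i..j] (inclusive), for 1 ≤ i
sub : BinString → ℕ → ℕ → BinString
sub s i j = take (1 + j ∸ i) (drop (i ∸ 1) s)

pblockInterchange : ℕ → ℕ → ℕ → BinString → BinString
pblockInterchange x y z s =
  sub s y z ++ sub s (1 + x) (y ∸ 1) ++ sub s 1 x ++ drop z s

Applicable : ℕ → ℕ → ℕ → BinString → Set
Applicable x y z s = (1 ≤ x) × (x < y) × (y ≤ z) × (z ≤ length s)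

module Submission where

-- Over the alphabet {0,1} a normalized string is determined by
-- its first symbol a and its length: it is the alternating string
-- a ā a ā a …  (ā = not a).  If the length is at least 5 the string is
-- a ā a ā a t, and the interchange β(1,1,4,4), which swaps the first and
-- the fourth symbol, turns it into ā ā a a a t.  Normalizing merges the
-- two leading ā's and the three a's, so the normal form is ā a t: exactly
-- three symbols shorter.

open import Defs
open import Data.Nat using (ℕ; zero; suc; _+_; _≤_; _∸_; s≤s; z≤n)
open import Data.Nat.Properties using (m≤n⇒∃[o]m+o≡n)
open import Data.List using ([]; _∷_; length)
open import Data.Bool using (Bool; true; false; not)
open import Data.Product using (_×_; ∃-syntax; _,_)
open import Data.Empty using (⊥-elim)
open import Relation.Binary.PropositionalEquality
  using (_≡_; refl; sym; trans; cong; subst; module ≡-Reasoning)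

alternating : Bool → ℕ → BinString
alternating a zero    = []
alternating a (suc n) = a ∷ alternating (not a) n

normalized⇒alternating : ∀ {a s} → Normalized (a ∷ s) →
  a ∷ s ≡ alternating a (suc (length s))
normalized⇒alternating (one a) = refl
normalized⇒alternating (cons true  true  s a≢b p) = ⊥-elim (a≢b refl)
normalized⇒alternating (cons true  false s a≢b p) = cong (true ∷_) (normalized⇒alternating p)
normalized⇒alternating (cons false true  s a≢b p) = cong (false ∷_) (normalized⇒alternating p)
normalized⇒alternating (cons false false s a≢b p) = ⊥-elim (a≢b refl)

normalize-from-repeat : ∀ a s → normalize-from a (a ∷ s) ≡ normalize-from a s
normalize-from-repeat true  s = refl
normalize-from-repeat false s = refl

normalize-from-switch : ∀ a s → normalize-from (not a) (a ∷ s) ≡ not a ∷ normalize-from a s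
normalize-from-switch true  s = refl
normalize-from-switch false s = refl

normalize-from-alternating : ∀ a m →
  normalize-from a (alternating (not a) m) ≡ alternating a (suc m)
normalize-from-alternating true  zero    = refl
normalize-from-alternating false zero    = refl
normalize-from-alternating true  (suc m) = cong (true ∷_) (normalize-from-alternating false m)
normalize-from-alternating false (suc m) = cong (false ∷_) (normalize-from-alternating true m)

normalize-swapped : ∀ a m →
  normalize (not a ∷ not a ∷ a ∷ a ∷ a ∷ alternating (not a) m)
    ≡ not a ∷ alternating a (suc m)
normalize-swapped a m = begin
  normalize-from (not a) (not a ∷ a ∷ a ∷ a ∷ t) ≡⟨ normalize-from-repeat (not a) _ ⟩
  normalize-from (not a) (a ∷ a ∷ a ∷ t)         ≡⟨ normalize-from-switch a _ ⟩
  not a ∷ normalize-from a (a ∷ a ∷ t)           ≡⟨ cong (not a ∷_) (normalize-from-repeat a _) ⟩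
  not a ∷ normalize-from a (a ∷ t)               ≡⟨ cong (not a ∷_) (normalize-from-repeat a _) ⟩
  not a ∷ normalize-from a t                     ≡⟨ cong (not a ∷_) (normalize-from-alternating a m) ⟩
  not a ∷ alternating a (suc m)                  ∎
  where
  open ≡-Reasoning
  t : BinString
  t = alternating (not a) m

Has3PBlockInterchange : BinString → Set
Has3PBlockInterchange s = ∃[ x ] ∃[ y ] ∃[ z ] (Applicable x y z s ×
  length (normalize (pblockInterchange x y z s)) ≡ length s ∸ 3)

swap-1-4-applicable : ∀ s → 4 ≤ length s → Applicable 1 4 4 s
swap-1-4-applicable s 4≤n = s≤s z≤n , s≤s (s≤s z≤n) , s≤s (s≤s (s≤s (s≤s z≤n))) , 4≤n

-- The interchange itself computes by take/drop on the
-- concrete five-symbol prefix; the case split on a lets not (not a) reduce.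
alternating-3pblockInterchange : ∀ a m → Has3PBlockInterchange (alternating a (5 + m))
alternating-3pblockInterchange true m =
  1 , 4 , 4 , swap-1-4-applicable (alternating true (5 + m)) (s≤s (s≤s (s≤s (s≤s z≤n)))) ,
  cong length (normalize-swapped true m)
alternating-3pblockInterchange false m =
  1 , 4 , 4 , swap-1-4-applicable (alternating false (5 + m)) (s≤s (s≤s (s≤s (s≤s z≤n)))) ,
  cong length (normalize-swapped false m)

lemma1 : ∀ (s : BinString) → FullyNormalized s → 5 ≤ length s →
    ∃[ x ] ∃[ y ] ∃[ z ] (Applicable x y z s ×
      length (normalize (pblockInterchange x y z s)) ≡ length s ∸ 3)
lemma1 [] _ ()
lemma1 (a ∷ s) (normalized , _) 5≤n with m≤n⇒∃[o]m+o≡n 5≤n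
... | m , 5+m≡n = subst Has3PBlockInterchange (sym s-alternating)
                    (alternating-3pblockInterchange a m)
  where
  s-alternating : a ∷ s ≡ alternating a (5 + m)
  s-alternating = trans (normalized⇒alternating normalized)
                        (cong (alternating a) (sym 5+m≡n))
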